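{- The category $\mathsf{SContFCov}$ of strong continuous finitary covers and join-approximable maps is equivalent to the category $\mathsf{SPxJLat}$ of strong proximity $\vee$-semilattices and join-approximable relations.
   Context: Work constructively; $\mathrm{Fin}(S)$ = finitely enumerable subsets. A finitary cover is $(S,\blacktriangleleft)$ with $\blacktriangleleft\subseteq S\times\mathrm{Fin}(S)$ such that $a\in A\Rightarrow a\blacktriangleleft A$; $a\blacktriangleleft A\Rightarrow a\blacktriangleleft A\cup B$; $a\blacktriangleleft A\cup\{b\}\ \&\ b\blacktriangleleft A\Rightarrow a\blacktriangleleft A$. A strong continuous finitary cover is $(S,\blacktriangleleft,\sqsubset)$ with $(S,\blacktriangleleft)$ a finitary cover and $\sqsubset$ an idempotent relation on $S$ ($\sqsubset\circ\sqsubset=\sqsubset$) such that $\exists b\,(a\sqsubset b\blacktriangleleft A)\iff\exists B\in\mathrm{Fin}(S)\,(a\blacktriangleleft B\ \&\ \forall b\in B\,\exists c\in A\,(b\sqsubset c))$. Define $a\ll_{\blacktriangleleft}A\iff\exists b\,(a\sqsubset b\blacktriangleleft A)$. Cut composition of $r\subseteq S\times\mathrm{Fin}(S')$, $s\subseteq S'\times\mathrm{Fin}(S'')$: $a\,(s\cdot r)\,C\iff\exists B\,(a\,r\,B\ \&\ \forall b\in B\,(b\,s\,C))$. A join-approximable map $(S,\blacktriangleleft,\sqsubset)\to(S',\blacktriangleleft',\sqsubset')$ is $r\subseteq S\times\mathrm{Fin}(S')$ with $r\cdot\ll_{\blacktriangleleft}=r=\ll_{\blacktriangleleft'}\cdot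 r$ and $a\,r\,B\Rightarrow\exists A\in\mathrm{Fin}(S)\,(a\blacktriangleleft A\ \&\ \forall a'\in A\,\exists b\in B\,(a'\,r\,\{b\}))$. $\mathsf{SContFCov}$: identity $\ll_\blacktriangleleft$, composition cut composition. A proximity $\vee$-semilattice is $(S,0,\vee,\prec)$, $(S,\le,0,\vee)$ a join-semilattice and $\prec$ a relation such that for all $a$, $\{b\mid b\prec a\}$ is a rounded ideal (downward closed, inhabited, directed $I$ with $x\in I\iff\exists y\,(x\prec y\ \&\ y\in I)$) and $\{b\mid a\prec b\}$ a rounded upward closed set ($x\in U\iff\exists y\,(y\prec x\ \&\ y\in U)$). Strong: $a\prec0\Rightarrow a=0$ and $a\prec b\vee c\Rightarrow\exists b',c'\,(a\le b'\vee c'\ \&\ b'\prec b\ \&\ c'\prec c)$. A join-approximable relation $S\to S'$ is $r\subseteq S\times S'$ with each $\{a\mid a\,r\,b\}$ a rounded ideal, each $\{b\mid a\,r\,b\}$ a rounded upward closed set, $a\,r\,0'\Rightarrow a=0$, and $a\,r\,(b\vee'c)\Rightarrow\exists b',c'\,(a\le b'\vee c'\ \&\ b'\,r\,b\ \&\ c'\,r\,c)$. $\mathsf{SPxJLat}$: identity $\prec$, relational composition. -}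

module Defs where

open import Level using (Level; _⊔_; 0ℓ) renaming (suc to lsuc)
open import Data.List using (List; []; _∷_; _++_; [_])
open import Data.List.Membership.Propositional using (_∈_)
open import Data.Product using (Σ; Σ-syntax; ∃; ∃-syntax; _×_; _,_; proj₁; proj₂)
open import Function.Bundles using (_⇔_)
open import Relation.Binary.Structures using (IsEquivalence)
open import Relation.Binary.Lattice.Bundles using (BoundedJoinSemilattice)

record PreCat (o h e : Level) : Set (lsuc (o ⊔ h ⊔ e)) where
  infixr 9 _∘_
  infix 4 _≈_
  field
    Obj : Set o
    Hom : Obj → Obj → Set h
    _≈_ : ∀ {X Y} → Hom X Y → Hom X Y → Set e
    id  : ∀ {X} → Hom X X
    _∘_ : ∀ {X Y Z} → Hom Y Z → Hom X Y → Hom X Z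

record IsCategory {o h e} (C : PreCat o h e) : Set (o ⊔ h ⊔ e) where
  open PreCat C
  field
    ≈-equiv   : ∀ {X Y} → IsEquivalence (_≈_ {X} {Y})
    ∘-resp-≈  : ∀ {X Y Z} {f f′ : Hom Y Z} {g g′ : Hom X Y} →
                f ≈ f′ → g ≈ g′ → f ∘ g ≈ f′ ∘ g′
    identityˡ : ∀ {X Y} {f : Hom X Y} → id ∘ f ≈ f
    identityʳ : ∀ {X Y} {f : Hom X Y} → f ∘ id ≈ f
    assoc     : ∀ {W X Y Z} {f : Hom W X} {g : Hom X Y} {k : Hom Y Z} →
                (k ∘ g) ∘ f ≈ k ∘ (g ∘ f)

record Functor {o h e o′ h′ e′} (C : PreCat o h e) (D : PreCat o′ h′ e′)
       : Set (o ⊔ h ⊔ e ⊔ o′ ⊔ h′ ⊔ e′) where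
  private
    module C = PreCat C
    module D = PreCat D
  field
    F₀     : C.Obj → D.Obj
    F₁     : ∀ {X Y} → C.Hom X Y → D.Hom (F₀ X) (F₀ Y)
    F-resp : ∀ {X Y} {f g : C.Hom X Y} → f C.≈ g → F₁ f D.≈ F₁ g
    F-id   : ∀ {X} → F₁ (C.id {X}) D.≈ D.id
    F-∘    : ∀ {X Y Z} (f : C.Hom X Y) (g : C.Hom Y Z) →
             F₁ (g C.∘ f) D.≈ F₁ g D.∘ F₁ f

record Equivalence {o h e o′ h′ e′} (C : PreCat o h e) (D : PreCat o′ h′ e′)
       : Set (o ⊔ h ⊔ e ⊔ o′ ⊔ h′ ⊔ e′) where
  private
    module C = PreCat C
    module D = PreCat D
  field
    F : Functor C D
    G : Functor D C
  private
    module F = Functor F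
    module G = Functor G
  field
    η        : ∀ X → C.Hom X (G.F₀ (F.F₀ X))
    η⁻¹      : ∀ X → C.Hom (G.F₀ (F.F₀ X)) X
    η-isoˡ   : ∀ X → η⁻¹ X C.∘ η X C.≈ C.id
    η-isoʳ   : ∀ X → η X C.∘ η⁻¹ X C.≈ C.id
    η-natural : ∀ {X Y} (f : C.Hom X Y) →
                η Y C.∘ f C.≈ G.F₁ (F.F₁ f) C.∘ η X
    ε        : ∀ Y → D.Hom (F.F₀ (G.F₀ Y)) Y
    ε⁻¹      : ∀ Y → D.Hom Y (F.F₀ (G.F₀ Y))
    ε-isoˡ   : ∀ Y → ε⁻¹ Y D.∘ ε Y D.≈ D.id
    ε-isoʳ   : ∀ Y → ε Y D.∘ ε⁻¹ Y D.≈ D.id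
    ε-natural : ∀ {X Y} (g : D.Hom X Y) →
                ε Y D.∘ F.F₁ (G.F₁ g) D.≈ g D.∘ ε X

-- Finitely enumerable subsets, represented by lists; membership is
-- list membership, A ∪ B is A ++ B, {b} is [ b ].

Fin : Set → Set
Fin S = List S

_≐_ : {S : Set} → Fin S → Fin S → Set
A ≐ B = ∀ x → (x ∈ A) ⇔ (x ∈ B)

record SContFCovObj : Set₁ where
  field
    S   : Set
    _◂_ : S → Fin S → Set
    _⊏_ : S → S → Set
    -- ◂ is a relation between S and finite SUBSETS of S
    ◂-ext    : ∀ {a A B} → A ≐ B → a ◂ A → a ◂ B
    ◂-refl   : ∀ {a A} → a ∈ A → a ◂ A
    ◂-weaken : ∀ {a} A B → a ◂ A → a ◂ (A ++ B)
    ◂-cut    : ∀ {a b} A → a ◂ (A ++ [ b ]) → b ◂ A → a ◂ A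
    ⊏-idem   : ∀ a c → (Σ[ b ∈ S ] (a ⊏ b × b ⊏ c)) ⇔ (a ⊏ c)
    strong   : ∀ a A →
               (Σ[ b ∈ S ] (a ⊏ b × b ◂ A)) ⇔
               (Σ[ B ∈ Fin S ] (a ◂ B × (∀ b → b ∈ B → Σ[ c ∈ S ] (c ∈ A × b ⊏ c))))

  _≪_ : S → Fin S → Set
  a ≪ A = Σ[ b ∈ S ] (a ⊏ b × b ◂ A)

open SContFCovObj

FRel : SContFCovObj → SContFCovObj → Set₁
FRel X Y = S X → Fin (S Y) → Set

cutComp : ∀ X Y Z → FRel Y Z → FRel X Y → FRel X Z
cutComp X Y Z s r a C = Σ[ B ∈ Fin (S Y) ] (r a B × (∀ b → b ∈ B → s b C))

FRelEq : ∀ X Y → FRel X Y → FRel X Y → Set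
FRelEq X Y r r′ = ∀ a B → r a B ⇔ r′ a B

record IsJAMap (X Y : SContFCovObj) (r : FRel X Y) : Set where
  field
    r-ext   : ∀ {a B B′} → B ≐ B′ → r a B → r a B′
    r-left  : FRelEq X Y (cutComp X X Y r (_≪_ X)) r
    r-right : FRelEq X Y r (cutComp X Y Y (_≪_ Y) r)
    r-split : ∀ a B → r a B →
              Σ[ A ∈ Fin (S X) ] (_◂_ X a A ×
                (∀ a′ → a′ ∈ A → Σ[ b ∈ S Y ] (b ∈ B × r a′ [ b ])))

record JAMap (X Y : SContFCovObj) : Set₁ where
  field
    rel   : FRel X Y
    isMap : IsJAMap X Y rel

SContIdOK : Set₁
SContIdOK = ∀ X → IsJAMap X X (_≪_ X)

SContCompOK : Set₁
SContCompOK = ∀ {X Y Z} (r : FRel X Y) (s : FRel Y Z) →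
              IsJAMap X Y r → IsJAMap Y Z s → IsJAMap X Z (cutComp X Y Z s r)

SContFCov : SContIdOK → SContCompOK → PreCat (lsuc 0ℓ) (lsuc 0ℓ) 0ℓ
SContFCov idOK compOK = record
  { Obj = SContFCovObj
  ; Hom = JAMap
  ; _≈_ = λ {X} {Y} f g → FRelEq X Y (JAMap.rel f) (JAMap.rel g)
  ; id  = λ {X} → record { rel = _≪_ X ; isMap = idOK X }
  ; _∘_ = λ {X} {Y} {Z} g f → record
      { rel = cutComp X Y Z (JAMap.rel g) (JAMap.rel f)
      ; isMap = compOK {X} {Y} {Z} (JAMap.rel f) (JAMap.rel g) (JAMap.isMap f) (JAMap.isMap g) } }

module _ (L : BoundedJoinSemilattice 0ℓ 0ℓ 0ℓ) where
  open BoundedJoinSemilattice L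

  record IsRoundedIdeal (_≺_ : Carrier → Carrier → Set) (I : Carrier → Set) : Set where
    field
      down     : ∀ {x y} → x ≤ y → I y → I x
      inhabited : Σ[ x ∈ Carrier ] I x
      directed : ∀ {x y} → I x → I y → Σ[ z ∈ Carrier ] (I z × x ≤ z × y ≤ z)
      rounded  : ∀ x → I x ⇔ (Σ[ y ∈ Carrier ] (x ≺ y × I y))

  record IsRoundedUpset (_≺_ : Carrier → Carrier → Set) (U : Carrier → Set) : Set where
    field
      up      : ∀ {x y} → x ≤ y → U x → U y
      rounded : ∀ x → U x ⇔ (Σ[ y ∈ Carrier ] (y ≺ x × U y))

record SPxJLatObj : Set₁ where
  field
    lat : BoundedJoinSemilattice 0ℓ 0ℓ 0ℓ
  open BoundedJoinSemilattice lat
  field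
    _≺_    : Carrier → Carrier → Set
    ≺-ideal : ∀ a → IsRoundedIdeal lat _≺_ (λ b → b ≺ a)
    ≺-upset : ∀ a → IsRoundedUpset lat _≺_ (λ b → a ≺ b)
    ≺-⊥    : ∀ {a} → a ≺ ⊥ → a ≈ ⊥
    ≺-∨    : ∀ {a b c} → a ≺ (b ∨ c) →
             Σ[ b′ ∈ Carrier ] Σ[ c′ ∈ Carrier ] (a ≤ (b′ ∨ c′) × b′ ≺ b × c′ ≺ c)

open SPxJLatObj

Car : SPxJLatObj → Set
Car X = BoundedJoinSemilattice.Carrier (lat X)

PRel : SPxJLatObj → SPxJLatObj → Set₁
PRel X Y = Car X → Car Y → Set

relComp : ∀ X Y Z → PRel Y Z → PRel X Y → PRel X Z
relComp X Y Z s r a c = Σ[ b ∈ Car Y ] (r a b × s b c)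

PRelEq : ∀ X Y → PRel X Y → PRel X Y → Set
PRelEq X Y r r′ = ∀ a b → r a b ⇔ r′ a b

record IsJARel (X Y : SPxJLatObj) (r : PRel X Y) : Set where
  private
    module X = BoundedJoinSemilattice (lat X)
    module Y = BoundedJoinSemilattice (lat Y)
  field
    r-ideal : ∀ b → IsRoundedIdeal (lat X) (_≺_ X) (λ a → r a b)
    r-upset : ∀ a → IsRoundedUpset (lat Y) (_≺_ Y) (λ b → r a b)
    r-⊥     : ∀ {a} → r a Y.⊥ → a X.≈ X.⊥
    r-∨     : ∀ {a b c} → r a (b Y.∨ c) →
              Σ[ b′ ∈ Car X ] Σ[ c′ ∈ Car X ] (a X.≤ (b′ X.∨ c′) × r b′ b × r c′ c)

record JARel (X Y : SPxJLatObj) : Set₁ where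
  field
    rel   : PRel X Y
    isRel : IsJARel X Y rel

SPxIdOK : Set₁
SPxIdOK = ∀ X → IsJARel X X (_≺_ X)

SPxCompOK : Set₁
SPxCompOK = ∀ {X Y Z} (r : PRel X Y) (s : PRel Y Z) →
            IsJARel X Y r → IsJARel Y Z s → IsJARel X Z (relComp X Y Z s r)

SPxJLat : SPxIdOK → SPxCompOK → PreCat (lsuc 0ℓ) (lsuc 0ℓ) 0ℓ
SPxJLat idOK compOK = record
  { Obj = SPxJLatObj
  ; Hom = JARel
  ; _≈_ = λ {X} {Y} f g → PRelEq X Y (JARel.rel f) (JARel.rel g)
  ; id  = λ {X} → record { rel = _≺_ X ; isRel = idOK X }
  ; _∘_ = λ {X} {Y} {Z} g f → record
      { rel = relComp X Y Z (JARel.rel g) (JARel.rel f)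
      ; isRel = compOK {X} {Y} {Z} (JARel.rel f) (JARel.rel g) (JARel.isRel f) (JARel.isRel g) } }

-- A cover X gives the proximity lattice of its finite subsets, with A ≤ B when B covers every
-- point of A, union as join and pointwise ≪ as proximity; a map r acts pointwise. A proximity
-- lattice L gives the cover on its carrier with a ◂ A iff a ≤ ⋁ A and ⊏ = ≺; a relation g becomes
-- (a , B) ↦ g a (⋁ B). Neither identity (≪, ≺) is reflexive, so every law holds only up to an
-- interpolation step, which rounding and strong continuity always supply; in particular the unit
-- a ↦ {𝒜 | a ≪ ⋃ 𝒜} and the counit A ↦ {b | ⋁ A ≺ b} have inverses built from ≪ and ≺ again.
module Submission where

open import Level using (0ℓ) renaming (suc to lsuc)
open import Data.List using (List; []; _∷_; _++_; [_]; concat; map; foldr)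
open import Data.List.Membership.Propositional using (_∈_)
open import Data.List.Membership.Propositional.Properties
  using (∈-++⁺ˡ; ∈-++⁺ʳ; ∈-++⁻; ∈-concat⁺′; ∈-concat⁻′; ∈-map⁻)
open import Data.List.Properties using (concat-map-[_])
open import Data.List.Relation.Binary.Permutation.Propositional using (_↭_; ↭-sym)
open import Data.List.Relation.Binary.Permutation.Propositional.Properties using (∈-resp-↭; ∷↭∷ʳ)
open import Data.List.Relation.Binary.Subset.Propositional using (_⊆_)
open import Data.List.Relation.Binary.Subset.Propositional.Properties
  using (⊆-trans; ⊆-reflexive; xs⊆xs++ys; xs⊆ys++xs; ++⁺ʳ; concat⁺)
open import Data.List.Relation.Unary.Any using (here; there)
open import Data.Product using (Σ; Σ-syntax; _×_; _,_; proj₁)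
open import Data.Sum using (_⊎_; inj₁; inj₂; [_,_]′)
open import Function.Base using (_∘_; id)
open import Function.Bundles using (_⇔_; mk⇔)
open import Function.Properties.Equivalence using (⇔-isEquivalence)
open import Relation.Binary.Lattice.Bundles using (BoundedJoinSemilattice)
open import Relation.Binary.Lattice.Properties.JoinSemilattice using (∨-monotonic)
open import Relation.Binary.PropositionalEquality using (_≡_; refl; sym)
open import Relation.Binary.Structures using (IsEquivalence)
import Relation.Binary.Construct.On as On
open import Defs

open Function.Bundles.Equivalence using (to; from)
open IsEquivalence (⇔-isEquivalence {ℓ = 0ℓ}) using ()
  renaming (refl to ⇔-refl; sym to ⇔-sym; trans to ⇔-trans)

⇔₂-isEquivalence : {I J : Set} → IsEquivalence {A = I → J → Set} (λ r r′ → ∀ i j → r i j ⇔ r′ i j)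
⇔₂-isEquivalence = record
  { refl  = λ _ _ → ⇔-refl
  ; sym   = λ r⇔r′ i j → ⇔-sym (r⇔r′ i j)
  ; trans = λ r⇔r′ r′⇔r″ i j → ⇔-trans (r⇔r′ i j) (r′⇔r″ i j) }

≐⇒⊆ : {S : Set} {A B : Fin S} → A ≐ B → A ⊆ B
≐⇒⊆ A≐B {x} = to (A≐B x)

↭⇒≐ : {S : Set} {A B : Fin S} → A ↭ B → A ≐ B
↭⇒≐ A↭B _ = mk⇔ (∈-resp-↭ A↭B) (∈-resp-↭ (↭-sym A↭B))

all-[_] : {S : Set} {P : S → Set} {x : S} → P x → ∀ y → y ∈ [ x ] → P y
all-[ p ] _ (here refl) = p

all-++ : {S : Set} {P : S → Set} {A B : List S} →
         (∀ x → x ∈ A → P x) → (∀ x → x ∈ B → P x) → ∀ x → x ∈ A ++ B → P x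
all-++ {A = A} PA PB x = [ PA x , PB x ]′ ∘ ∈-++⁻ A

all-concat : {S : Set} {P : S → Set} {𝒜 : List (List S)} →
             (∀ A → A ∈ 𝒜 → ∀ x → x ∈ A → P x) → ∀ x → x ∈ concat 𝒜 → P x
all-concat {𝒜 = 𝒜} P𝒜 x x∈∪𝒜 = let A , x∈A , A∈𝒜 = ∈-concat⁻′ 𝒜 x∈∪𝒜 in P𝒜 A A∈𝒜 x x∈A

[_]⊆ : {S : Set} {x : S} {A : List S} → x ∈ A → [ x ] ⊆ A
[ x∈A ]⊆ (here refl) = x∈A

noWitness⇒⊆[] : {S T : Set} {P : S → T → Set} {D : List S} →
                (∀ d → d ∈ D → Σ[ c ∈ T ] (c ∈ [] × P d c)) → D ⊆ []
noWitness⇒⊆[] witness {d} d∈D with witness d d∈D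
... | _ , () , _

module _ {S T : Set} {Q : S → T → Set} {R : T → Set} where

  choose : (A : List S) → (∀ a → a ∈ A → Σ[ b ∈ T ] (Q a b × R b)) →
           Σ[ B ∈ List T ] ((∀ a → a ∈ A → Σ[ b ∈ T ] (b ∈ B × Q a b)) × (∀ b → b ∈ B → R b))
  choose []      f = [] , (λ _ ()) , (λ _ ())
  choose (a ∷ A) f with f a (here refl) | choose A (λ x x∈A → f x (there x∈A))
  ... | b , qab , rb | B , chosen , valid = b ∷ B , chosen′ , valid′
    where
    chosen′ : ∀ x → x ∈ a ∷ A → Σ[ y ∈ T ] (y ∈ b ∷ B × Q x y)
    chosen′ _ (here refl) = b , here refl , qab
    chosen′ x (there x∈A) = let y , y∈B , qxy = chosen x x∈A in y , there y∈B , qxy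
    valid′ : ∀ y → y ∈ b ∷ B → R y
    valid′ _ (here refl) = rb
    valid′ y (there y∈B) = valid y y∈B

module _ {S T : Set} {Q : S → List T → Set} {R : T → Set} where

  chooseUnion : (A : List S) → (∀ a → a ∈ A → Σ[ B ∈ List T ] (Q a B × (∀ b → b ∈ B → R b))) →
                Σ[ C ∈ List T ] ((∀ a → a ∈ A → Σ[ B ∈ List T ] (Q a B × B ⊆ C)) × (∀ c → c ∈ C → R c))
  chooseUnion A f with choose {R = λ B → ∀ b → b ∈ B → R b} A f
  ... | 𝓑 , chosen , valid = concat 𝓑 , chosen′ , valid′
    where
    chosen′ : ∀ a → a ∈ A → Σ[ B ∈ List T ] (Q a B × B ⊆ concat 𝓑)
    chosen′ a a∈A = let B , B∈𝓑 , qaB = chosen a a∈A in B , qaB , λ b∈B → ∈-concat⁺′ b∈B B∈𝓑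
    valid′ : ∀ c → c ∈ concat 𝓑 → R c
    valid′ c c∈∪ = let B , c∈B , B∈𝓑 = ∈-concat⁻′ 𝓑 c∈∪ in valid B B∈𝓑 c c∈B

module _ {S : Set} {P Q : S → Set} where

  partition⊎ : (D : List S) → (∀ d → d ∈ D → P d ⊎ Q d) →
               Σ[ D₁ ∈ List S ] Σ[ D₂ ∈ List S ]
                 (D ⊆ D₁ ++ D₂ × (∀ x → x ∈ D₁ → P x) × (∀ x → x ∈ D₂ → Q x))
  partition⊎ []      _ = [] , [] , (λ ()) , (λ _ ()) , (λ _ ())
  partition⊎ (d ∷ D) f with f d (here refl) | partition⊎ D (λ x x∈D → f x (there x∈D))
  ... | inj₁ pd | D₁ , D₂ , D⊆ , all₁ , all₂ = d ∷ D₁ , D₂ , d∷D⊆ , all₁′ , all₂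
    where
    d∷D⊆ : d ∷ D ⊆ d ∷ D₁ ++ D₂
    d∷D⊆ (here refl) = here refl
    d∷D⊆ (there x∈D) = there (D⊆ x∈D)
    all₁′ : ∀ x → x ∈ d ∷ D₁ → P x
    all₁′ _ (here refl) = pd
    all₁′ x (there x∈D₁) = all₁ x x∈D₁
  ... | inj₂ qd | D₁ , D₂ , D⊆ , all₁ , all₂ = D₁ , d ∷ D₂ , d∷D⊆ , all₁ , all₂′
    where
    d∷D⊆ : d ∷ D ⊆ D₁ ++ d ∷ D₂
    d∷D⊆ (here refl) = ∈-++⁺ʳ D₁ (here refl)
    d∷D⊆ (there x∈D) = ++⁺ʳ D₁ there (D⊆ x∈D)
    all₂′ : ∀ x → x ∈ d ∷ D₂ → Q x
    all₂′ _ (here refl) = qd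
    all₂′ x (there x∈D₂) = all₂ x x∈D₂

module CoverProperties (X : SContFCovObj) where
  open SContFCovObj X

  infix 4 _◂*_ _≪*_ _⊏*_

  _◂*_ : Fin S → Fin S → Set
  A ◂* B = ∀ a → a ∈ A → a ◂ B

  _≪*_ : Fin S → Fin S → Set
  A ≪* B = ∀ a → a ∈ A → a ≪ B

  _⊏*_ : Fin S → Fin S → Set
  B ⊏* A = ∀ b → b ∈ B → Σ[ c ∈ S ] (c ∈ A × b ⊏ c)

  ◂-⊆ : ∀ {a A B} → a ◂ A → A ⊆ B → a ◂ B
  ◂-⊆ {A = A} {B} a◂A A⊆B = ◂-ext A++B≐B (◂-weaken A B a◂A)
    where
    A++B≐B : (A ++ B) ≐ B
    A++B≐B _ = mk⇔ ([ A⊆B , id ]′ ∘ ∈-++⁻ A) (∈-++⁺ʳ A)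

  -- Weaken a ◂ A to a ◂ A ∪ B, then cut away the points of A one at a time.
  ◂-trans : ∀ {a A B} → a ◂ A → A ◂* B → a ◂ B
  ◂-trans {a} {A} {B} a◂A A◂*B = cutAll A (◂-weaken A B a◂A) A◂*B
    where
    cutAll : ∀ C → a ◂ (C ++ B) → C ◂* B → a ◂ B
    cutAll []      a◂B     _      = a◂B
    cutAll (c ∷ C) a◂c∷C+B c∷C◂*B = cutAll C a◂C+B (λ x x∈C → c∷C◂*B x (there x∈C))
      where
      a◂C+B : a ◂ (C ++ B)
      a◂C+B = ◂-cut (C ++ B) (◂-ext (↭⇒≐ (∷↭∷ʳ c (C ++ B))) a◂c∷C+B)
                    (◂-⊆ (c∷C◂*B c (here refl)) (xs⊆ys++xs B C))

  ⊆⇒◂* : ∀ {A B} → A ⊆ B → A ◂* B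
  ⊆⇒◂* A⊆B _ a∈A = ◂-refl (A⊆B a∈A)

  ◂*-refl : ∀ {A} → A ◂* A
  ◂*-refl _ = ◂-refl

  ◂*-trans : ∀ {A B C} → A ◂* B → B ◂* C → A ◂* C
  ◂*-trans A◂*B B◂*C a a∈A = ◂-trans (A◂*B a a∈A) B◂*C

  ⊏-trans : ∀ {a b c} → a ⊏ b → b ⊏ c → a ⊏ c
  ⊏-trans a⊏b b⊏c = to (⊏-idem _ _) (_ , a⊏b , b⊏c)

  ⊏-interpolate : ∀ {a c} → a ⊏ c → Σ[ b ∈ S ] (a ⊏ b × b ⊏ c)
  ⊏-interpolate = from (⊏-idem _ _)

  ≪⇒◂⊏* : ∀ {a A} → a ≪ A → Σ[ B ∈ Fin S ] (a ◂ B × B ⊏* A)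
  ≪⇒◂⊏* = to (strong _ _)

  ◂⊏*⇒≪ : ∀ {a A B} → a ◂ B → B ⊏* A → a ≪ A
  ◂⊏*⇒≪ a◂B B⊏*A = from (strong _ _) (_ , a◂B , B⊏*A)

  ⊏-∈⇒≪ : ∀ {a b A} → a ⊏ b → b ∈ A → a ≪ A
  ⊏-∈⇒≪ a⊏b b∈A = _ , a⊏b , ◂-refl b∈A

  ⊏-≪-trans : ∀ {a b A} → a ⊏ b → b ≪ A → a ≪ A
  ⊏-≪-trans a⊏b (c , b⊏c , c◂A) = c , ⊏-trans a⊏b b⊏c , c◂A

  ≪-⊆ : ∀ {a A B} → a ≪ A → A ⊆ B → a ≪ B
  ≪-⊆ (b , a⊏b , b◂A) A⊆B = b , a⊏b , ◂-⊆ b◂A A⊆B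

  ≪-◂*-trans : ∀ {a A B} → a ≪ A → A ◂* B → a ≪ B
  ≪-◂*-trans (b , a⊏b , b◂A) A◂*B = b , a⊏b , ◂-trans b◂A A◂*B

  -- Strong continuity, applied to the witnesses y of x ⊏ y ◂ B for x ∈ A.
  ◂-≪*-trans : ∀ {a A B} → a ◂ A → A ≪* B → a ≪ B
  ◂-≪*-trans {B = B} a◂A A≪*B with choose {Q = _⊏_} {R = _◂ B} _ A≪*B
  ... | Y , A⊏*Y , Y◂*B = ≪-◂*-trans (◂⊏*⇒≪ a◂A A⊏*Y) Y◂*B

  ≪-≪*-trans : ∀ {a A B} → a ≪ A → A ≪* B → a ≪ B
  ≪-≪*-trans a≪A A≪*B with ≪⇒◂⊏* a≪A
  ... | D , a◂D , D⊏*A = ◂-≪*-trans a◂D D≪*B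
    where
    D≪*B : D ≪* _
    D≪*B d d∈D = let c , c∈A , d⊏c = D⊏*A d d∈D in ⊏-≪-trans d⊏c (A≪*B c c∈A)

  ≪-interpolate : ∀ {a A} → a ≪ A → Σ[ B ∈ Fin S ] (a ≪ B × B ≪* A)
  ≪-interpolate (b , a⊏b , b◂A) with ⊏-interpolate a⊏b
  ... | w , a⊏w , w⊏b with ≪⇒◂⊏* (b , w⊏b , b◂A)
  ... | D , w◂D , D⊏*A = D , (w , a⊏w , w◂D) , λ d d∈D →
    let c , c∈A , d⊏c = D⊏*A d d∈D in ⊏-∈⇒≪ d⊏c c∈A

  ≪-idem : ∀ a B → (Σ[ A ∈ Fin S ] (a ≪ A × A ≪* B)) ⇔ a ≪ B
  ≪-idem a B = mk⇔ (λ (A , a≪A , A≪*B) → ≪-≪*-trans a≪A A≪*B) ≪-interpolate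

  ≪[]⇒◂[] : ∀ {a} → a ≪ [] → a ◂ []
  ≪[]⇒◂[] a≪[] with ≪⇒◂⊏* a≪[]
  ... | D , a◂D , D⊏*[] = ◂-⊆ a◂D (noWitness⇒⊆[] D⊏*[])

  ≪*-trans : ∀ {A B C} → A ≪* B → B ≪* C → A ≪* C
  ≪*-trans A≪*B B≪*C a a∈A = ≪-≪*-trans (A≪*B a a∈A) B≪*C

  ≪*-◂*-trans : ∀ {A B C} → A ≪* B → B ◂* C → A ≪* C
  ≪*-◂*-trans A≪*B B◂*C a a∈A = ≪-◂*-trans (A≪*B a a∈A) B◂*C

  ◂*-≪*-trans : ∀ {A B C} → A ◂* B → B ≪* C → A ≪* C
  ◂*-≪*-trans A◂*B B≪*C a a∈A = ◂-≪*-trans (A◂*B a a∈A) B≪*C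

  ≪*-interpolate : ∀ {A B} → A ≪* B → Σ[ C ∈ Fin S ] (A ≪* C × C ≪* B)
  ≪*-interpolate {A} {B} A≪*B with chooseUnion {Q = _≪_} {R = _≪ B} A (λ a a∈A → ≪-interpolate (A≪*B a a∈A))
  ... | C , chosen , C≪*B = C , (λ a a∈A → let E , a≪E , E⊆C = chosen a a∈A in ≪-⊆ a≪E E⊆C) , C≪*B

  ◂*-partition : ∀ {P Q : S → Set} A →
                 (∀ a → a ∈ A → Σ[ D ∈ Fin S ] (a ◂ D × (∀ d → d ∈ D → P d ⊎ Q d))) →
                 Σ[ D₁ ∈ Fin S ] Σ[ D₂ ∈ Fin S ]
                   (A ◂* D₁ ++ D₂ × (∀ x → x ∈ D₁ → P x) × (∀ x → x ∈ D₂ → Q x))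
  ◂*-partition {P} {Q} A covers with chooseUnion {Q = _◂_} {R = λ d → P d ⊎ Q d} A covers
  ... | D , chosen , split with partition⊎ D split
  ... | D₁ , D₂ , D⊆ , all₁ , all₂ = D₁ , D₂ , A◂*D₁+D₂ , all₁ , all₂
    where
    A◂*D₁+D₂ : A ◂* D₁ ++ D₂
    A◂*D₁+D₂ a a∈A = let E , a◂E , E⊆D = chosen a a∈A in ◂-⊆ a◂E (⊆-trans E⊆D D⊆)

  ≪*-++-split : ∀ {B C} A → A ≪* B ++ C →
                Σ[ B′ ∈ Fin S ] Σ[ C′ ∈ Fin S ] (A ◂* B′ ++ C′ × B′ ≪* B × C′ ≪* C)
  ≪*-++-split {B} A A≪*B+C = ◂*-partition A λ a a∈A →
    let D , a◂D , D⊏*B+C = ≪⇒◂⊏* (A≪*B+C a a∈A) in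
    D , a◂D , λ d d∈D → let c , c∈B+C , d⊏c = D⊏*B+C d d∈D in
      [ (λ c∈B → inj₁ (⊏-∈⇒≪ d⊏c c∈B)) , (λ c∈C → inj₂ (⊏-∈⇒≪ d⊏c c∈C)) ]′ (∈-++⁻ B c∈B+C)

module JAMapProperties {X Y : SContFCovObj} {r : FRel X Y} (isJA : IsJAMap X Y r) where
  open IsJAMap isJA
  private
    module X = SContFCovObj X
    module CX = CoverProperties X
    module CY = CoverProperties Y

  r-⊆ : ∀ {a B B′} → r a B → B ⊆ B′ → r a B′
  r-⊆ {a} {B} {B′} raB B⊆B′ with to (r-right a B) raB
  ... | C , raC , C≪*B = from (r-right a B′) (C , raC , λ c c∈C → CY.≪-⊆ (C≪*B c c∈C) B⊆B′)

  r-◂*ʳ : ∀ {a B B′} → r a B → B CY.◂* B′ → r a B′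
  r-◂*ʳ {a} {B} {B′} raB B◂*B′ with to (r-right a B) raB
  ... | C , raC , C≪*B = from (r-right a B′) (C , raC , CY.≪*-◂*-trans C≪*B B◂*B′)

  r-≪ˡ : ∀ {a A B} → a X.≪ A → (∀ x → x ∈ A → r x B) → r a B
  r-≪ˡ {a} {A} {B} a≪A A-r = to (r-left a B) (A , a≪A , A-r)

  r-◂ˡ : ∀ {a A B} → a X.◂ A → (∀ x → x ∈ A → r x B) → r a B
  r-◂ˡ {A = A} {B} a◂A A-r
    with chooseUnion {Q = X._≪_} {R = λ e → r e B} A (λ x x∈A → from (r-left x B) (A-r x x∈A))
  ... | C , chosen , C-r = r-≪ˡ (CX.◂-≪*-trans a◂A A≪*C) C-r
    where
    A≪*C : A CX.≪* C
    A≪*C x x∈A = let E , x≪E , E⊆C = chosen x x∈A in CX.≪-⊆ x≪E E⊆C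

module _ {X Y Z : SContFCovObj} where

  cutComp-cong : ∀ {s s′ : FRel Y Z} {r r′ : FRel X Y} → FRelEq Y Z s s′ → FRelEq X Y r r′ →
                 FRelEq X Z (cutComp X Y Z s r) (cutComp X Y Z s′ r′)
  cutComp-cong s≈s′ r≈r′ a C = mk⇔
    (λ (B , raB , B-s) → B , to (r≈r′ a B) raB , λ b b∈B → to (s≈s′ b C) (B-s b b∈B))
    (λ (B , raB , B-s) → B , from (r≈r′ a B) raB , λ b b∈B → from (s≈s′ b C) (B-s b b∈B))

-- Only the middle relation has to be monotone: its values at the points of A are merged into one set.
cutComp-assoc : ∀ {W X Y Z} {r : FRel W X} {s : FRel X Y} {t : FRel Y Z} →
                (∀ {x B B′} → s x B → B ⊆ B′ → s x B′) →
                FRelEq W Z (cutComp W X Z (cutComp X Y Z t s) r) (cutComp W Y Z t (cutComp W X Y s r))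
cutComp-assoc {W} {X} {Y} {Z} {r} {s} {t} s-⊆ a D = mk⇔ reassociate
  (λ (B , (A , raA , A-s) , B-t) → A , raA , λ x x∈A → B , A-s x x∈A , B-t)
  where
  reassociate : cutComp W X Z (cutComp X Y Z t s) r a D → cutComp W Y Z t (cutComp W X Y s r) a D
  reassociate (A , raA , A-ts) with chooseUnion {Q = s} {R = λ b → t b D} A A-ts
  ... | B , chosen , B-t = B , (A , raA , λ x x∈A → let E , sxE , E⊆B = chosen x x∈A in s-⊆ sxE E⊆B) , B-t

≪-isJAMap : SContIdOK
≪-isJAMap X = record
  { r-ext   = λ B≐B′ a≪B → ≪-⊆ a≪B (≐⇒⊆ B≐B′)
  ; r-left  = ≪-idem
  ; r-right = λ a B → ⇔-sym (≪-idem a B)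
  ; r-split = λ a B a≪B → let D , a◂D , D⊏*B = ≪⇒◂⊏* a≪B in
      D , a◂D , λ d d∈D → let c , c∈B , d⊏c = D⊏*B d d∈D in c , c∈B , ⊏-∈⇒≪ d⊏c (here refl)
  }
  where open CoverProperties X

cutComp-isJAMap : SContCompOK
cutComp-isJAMap {X} {Y} {Z} r s isJA-r isJA-s = record
  { r-ext   = λ C≐C′ (B , raB , B-s) → B , raB , λ b b∈B → s-ext C≐C′ (B-s b b∈B)
  ; r-left  = λ a C → ⇔-trans (cutComp-assoc {X} {X} {Y} {Z} {X._≪_} {r} {s} Prop-r.r-⊆ a C)
                                (cutComp-cong {X} {Y} {Z} {s} {s} (λ _ _ → ⇔-refl) r-left a C)
  ; r-right = λ a C → ⇔-trans (cutComp-cong {X} {Y} {Z} {r = r} {r} s-right (λ _ _ → ⇔-refl) a C)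
                                (cutComp-assoc {X} {Y} {Z} {Z} {r} {s} {Z._≪_} Prop-s.r-⊆ a C)
  ; r-split = split
  }
  where
  module X = SContFCovObj X
  module Z = SContFCovObj Z
  module CX = CoverProperties X
  module Prop-r = JAMapProperties isJA-r
  module Prop-s = JAMapProperties isJA-s
  open IsJAMap isJA-r using (r-left; r-split)
  open IsJAMap isJA-s using () renaming (r-ext to s-ext; r-right to s-right; r-split to s-split)

  SplitsInto : FRel X Z → Fin Z.S → X.S → Set
  SplitsInto t C a = Σ[ A ∈ Fin X.S ] (a X.◂ A × (∀ a′ → a′ ∈ A → Σ[ c ∈ Z.S ] (c ∈ C × t a′ [ c ])))

  -- Split r, split s at each resulting b ∈ B, then split r again against the pieces of b.
  split : ∀ a C → cutComp X Y Z s r a C → SplitsInto (cutComp X Y Z s r) C a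
  split a C (B , raB , B-s) with r-split a B raB
  ... | A , a◂A , A-r with chooseUnion {Q = X._◂_} A refine
    where
    refine : ∀ a′ → a′ ∈ A → SplitsInto (cutComp X Y Z s r) C a′
    refine a′ a′∈A with A-r a′ a′∈A
    ... | b , b∈B , ra′b with s-split b C (B-s b b∈B)
    ... | D , b◂D , D-s with r-split a′ D (Prop-r.r-◂*ʳ ra′b all-[ b◂D ])
    ... | A′ , a′◂A′ , A′-r = A′ , a′◂A′ , λ a″ a″∈A′ →
      let d , d∈D , ra″d = A′-r a″ a″∈A′ ; c , c∈C , sdc = D-s d d∈D in
      c , c∈C , [ d ] , ra″d , all-[ sdc ]
  ... | A″ , chosen , A″-split = A″ , CX.◂-trans a◂A A◂*A″ , A″-split
    where
    A◂*A″ : A CX.◂* A″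
    A◂*A″ a′ a′∈A = let A′ , a′◂A′ , A′⊆A″ = chosen a′ a′∈A in CX.◂-⊆ a′◂A′ A′⊆A″

Covers : PreCat (lsuc 0ℓ) (lsuc 0ℓ) 0ℓ
Covers = SContFCov ≪-isJAMap cutComp-isJAMap

SContFCov-isCategory : IsCategory Covers
SContFCov-isCategory = record
  { ≈-equiv   = On.isEquivalence JAMap.rel ⇔₂-isEquivalence
  ; ∘-resp-≈  = λ {X} {Y} {Z} {f} {f′} {g} {g′} →
      cutComp-cong {X} {Y} {Z} {JAMap.rel f} {JAMap.rel f′} {JAMap.rel g} {JAMap.rel g′}
  ; identityˡ = λ {f = f} a B → ⇔-sym (IsJAMap.r-right (JAMap.isMap f) a B)
  ; identityʳ = λ {f = f} a B → IsJAMap.r-left (JAMap.isMap f) a B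
  ; assoc     = λ {W} {X} {Y} {Z} {f} {g} {k} → cutComp-assoc {W} {X} {Y} {Z} {JAMap.rel f} {JAMap.rel g} {JAMap.rel k}
                                      (JAMapProperties.r-⊆ (JAMap.isMap g))
  }

module BigJoin (L : BoundedJoinSemilattice 0ℓ 0ℓ 0ℓ) where
  open BoundedJoinSemilattice L renaming (refl to ≤-refl)

  ⋁ : List Carrier → Carrier
  ⋁ = foldr _∨_ ⊥

  ⋁-upperBound : ∀ {a A} → a ∈ A → a ≤ ⋁ A
  ⋁-upperBound {A = x ∷ A} (here refl) = x≤x∨y x (⋁ A)
  ⋁-upperBound {A = x ∷ A} (there a∈A) = trans (⋁-upperBound a∈A) (y≤x∨y x (⋁ A))

  ⋁-least : ∀ {A x} → (∀ a → a ∈ A → a ≤ x) → ⋁ A ≤ x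
  ⋁-least {[]}    {x} _   = minimum x
  ⋁-least {a ∷ A} A≤x = ∨-least (A≤x a (here refl)) (⋁-least (λ b b∈A → A≤x b (there b∈A)))

  ⋁-mono : ∀ {A B} → A ⊆ B → ⋁ A ≤ ⋁ B
  ⋁-mono A⊆B = ⋁-least (λ _ a∈A → ⋁-upperBound (A⊆B a∈A))

  ⋁-++ : ∀ A B → ⋁ (A ++ B) ≤ ⋁ A ∨ ⋁ B
  ⋁-++ A B = ⋁-least λ _ x∈A++B →
    [ (λ x∈A → trans (⋁-upperBound x∈A) (x≤x∨y _ _)) , (λ x∈B → trans (⋁-upperBound x∈B) (y≤x∨y _ _)) ]′
      (∈-++⁻ A x∈A++B)

  ⋁[x]≤x : ∀ x → ⋁ [ x ] ≤ x
  ⋁[x]≤x x = ⋁-least all-[ ≤-refl ]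

  x≤⋁[x] : ∀ x → x ≤ ⋁ [ x ]
  x≤⋁[x] x = ⋁-upperBound {A = [ x ]} (here refl)

  module _ {_≺_ : Carrier → Carrier → Set} {I : Carrier → Set} (isIdeal : IsRoundedIdeal L _≺_ I) where
    open IsRoundedIdeal isIdeal

    ideal-⊥ : I ⊥
    ideal-⊥ = let x , Ix = inhabited in down (minimum x) Ix

    ideal-∨ : ∀ {a b} → I a → I b → I (a ∨ b)
    ideal-∨ Ia Ib = let z , Iz , a≤z , b≤z = directed Ia Ib in down (∨-least a≤z b≤z) Iz

    ideal-⋁ : ∀ {A} → (∀ a → a ∈ A → I a) → I (⋁ A)
    ideal-⋁ {[]}    _  = ideal-⊥
    ideal-⋁ {a ∷ A} IA = ideal-∨ (IA a (here refl)) (ideal-⋁ (λ b b∈A → IA b (there b∈A)))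

module ProximityProperties (L : SPxJLatObj) where
  open SPxJLatObj L
  open BoundedJoinSemilattice lat using (Carrier; _≤_)
  open BigJoin lat public

  ≤-≺-trans : ∀ {a b c} → a ≤ b → b ≺ c → a ≺ c
  ≤-≺-trans {c = c} = IsRoundedIdeal.down (≺-ideal c)

  ≺-≤-trans : ∀ {a b c} → a ≺ b → b ≤ c → a ≺ c
  ≺-≤-trans {a} a≺b b≤c = IsRoundedUpset.up (≺-upset a) b≤c a≺b

  ≺-trans : ∀ {a b c} → a ≺ b → b ≺ c → a ≺ c
  ≺-trans {a} {b} {c} a≺b b≺c = from (IsRoundedIdeal.rounded (≺-ideal c) a) (b , a≺b , b≺c)

  ≺-interpolate : ∀ {a c} → a ≺ c → Σ[ b ∈ Carrier ] (a ≺ b × b ≺ c)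
  ≺-interpolate {a} {c} = to (IsRoundedIdeal.rounded (≺-ideal c) a)

  ⋁-≺ : ∀ {A c} → (∀ a → a ∈ A → a ≺ c) → ⋁ A ≺ c
  ⋁-≺ {c = c} = ideal-⋁ (≺-ideal c)

module JARelProperties {X Y : SPxJLatObj} {r : PRel X Y} (isJR : IsJARel X Y r) where
  open IsJARel isJR
  private
    module X = SPxJLatObj X
    module Y = SPxJLatObj Y
    module LX = BoundedJoinSemilattice X.lat
    module LY = BoundedJoinSemilattice Y.lat
    module PX = ProximityProperties X
    module PY = ProximityProperties Y

  ≤-r-trans : ∀ {a a′ b} → a LX.≤ a′ → r a′ b → r a b
  ≤-r-trans {b = b} = IsRoundedIdeal.down (r-ideal b)

  r-≤-trans : ∀ {a b b′} → r a b → b LY.≤ b′ → r a b′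
  r-≤-trans {a} rab b≤b′ = IsRoundedUpset.up (r-upset a) b≤b′ rab

  ≺-r-trans : ∀ {a a′ b} → a X.≺ a′ → r a′ b → r a b
  ≺-r-trans {a} {a′} {b} a≺a′ ra′b = from (IsRoundedIdeal.rounded (r-ideal b) a) (a′ , a≺a′ , ra′b)

  r-≺-trans : ∀ {a b b′} → r a b → b Y.≺ b′ → r a b′
  r-≺-trans {a} {b} {b′} rab b≺b′ = from (IsRoundedUpset.rounded (r-upset a) b′) (b , b≺b′ , rab)

  r-roundedˡ : ∀ {a b} → r a b → Σ[ a′ ∈ Car X ] (a X.≺ a′ × r a′ b)
  r-roundedˡ {a} {b} = to (IsRoundedIdeal.rounded (r-ideal b) a)

  r-roundedʳ : ∀ {a b} → r a b → Σ[ b′ ∈ Car Y ] (b′ Y.≺ b × r a b′)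
  r-roundedʳ {a} {b} = to (IsRoundedUpset.rounded (r-upset a) b)

  r-⋁-split : ∀ {a} B → r a (PY.⋁ B) →
              Σ[ A ∈ List (Car X) ] (a LX.≤ PX.⋁ A × (∀ a′ → a′ ∈ A → Σ[ b ∈ Car Y ] (b ∈ B × r a′ b)))
  r-⋁-split []      ra⊥ = [] , LX.reflexive (r-⊥ ra⊥) , λ _ ()
  r-⋁-split (b ∷ B) ra[b∨⋁B] with r-∨ ra[b∨⋁B]
  ... | b′ , c′ , a≤b′∨c′ , rb′b , rc′⋁B with r-⋁-split B rc′⋁B
  ... | A , c′≤⋁A , A-r = b′ ∷ A , LX.trans a≤b′∨c′ (∨-monotonic LX.joinSemilattice LX.refl c′≤⋁A) , b′∷A-r
    where
    b′∷A-r : ∀ a′ → a′ ∈ b′ ∷ A → Σ[ y ∈ Car Y ] (y ∈ b ∷ B × r a′ y)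
    b′∷A-r _  (here refl) = b , here refl , rb′b
    b′∷A-r a′ (there a′∈A) = let y , y∈B , ra′y = A-r a′ a′∈A in y , there y∈B , ra′y

≺-isJARel : SPxIdOK
≺-isJARel X = record
  { r-ideal = ≺-ideal ; r-upset = ≺-upset ; r-⊥ = ≺-⊥ ; r-∨ = ≺-∨ }
  where open SPxJLatObj X

relComp-isJARel : SPxCompOK
relComp-isJARel {X} {Y} {Z} r s isJR-r isJR-s = record
  { r-ideal = λ c → record
      { down      = λ a≤a′ (b , ra′b , sbc) → b , Prop-r.≤-r-trans a≤a′ ra′b , sbc
      ; inhabited = let b , sbc = IsRoundedIdeal.inhabited (s-ideal c)
                        a , rab = IsRoundedIdeal.inhabited (r-ideal b) in a , b , rab , sbc
      ; directed  = directed c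
      ; rounded   = λ a → mk⇔
          (λ (b , rab , sbc) → let a′ , a≺a′ , ra′b = Prop-r.r-roundedˡ rab in a′ , a≺a′ , b , ra′b , sbc)
          (λ (a′ , a≺a′ , b , ra′b , sbc) → b , Prop-r.≺-r-trans a≺a′ ra′b , sbc) }
  ; r-upset = λ a → record
      { up      = λ c≤c′ (b , rab , sbc) → b , rab , Prop-s.r-≤-trans sbc c≤c′
      ; rounded = λ c → mk⇔
          (λ (b , rab , sbc) → let c′ , c′≺c , sbc′ = Prop-s.r-roundedʳ sbc in c′ , c′≺c , b , rab , sbc′)
          (λ (c′ , c′≺c , b , rab , sbc′) → b , rab , Prop-s.r-≺-trans sbc′ c′≺c) }
  ; r-⊥ = λ (b , rab , sb⊥) → r-⊥ (Prop-r.r-≤-trans rab (LY.reflexive (s-⊥ sb⊥)))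
  ; r-∨ = λ (b , rab , sb[c∨d]) →
      let c′ , d′ , b≤c′∨d′ , sc′c , sd′d = s-∨ sb[c∨d]
          a₁ , a₂ , a≤a₁∨a₂ , ra₁c′ , ra₂d′ = r-∨ (Prop-r.r-≤-trans rab b≤c′∨d′) in
      a₁ , a₂ , a≤a₁∨a₂ , (c′ , ra₁c′ , sc′c) , (d′ , ra₂d′ , sd′d)
  }
  where
  module LX = BoundedJoinSemilattice (SPxJLatObj.lat X)
  module LY = BoundedJoinSemilattice (SPxJLatObj.lat Y)
  open IsJARel isJR-r
  open IsJARel isJR-s using () renaming (r-ideal to s-ideal; r-⊥ to s-⊥; r-∨ to s-∨)
  module Prop-r = JARelProperties isJR-r
  module Prop-s = JARelProperties isJR-s

  directed : ∀ c {x y} → relComp X Y Z s r x c → relComp X Y Z s r y c →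
             Σ[ z ∈ Car X ] (relComp X Y Z s r z c × x LX.≤ z × y LX.≤ z)
  directed c (b₁ , rxb₁ , sb₁c) (b₂ , ryb₂ , sb₂c) with IsRoundedIdeal.directed (s-ideal c) sb₁c sb₂c
  ... | b , sbc , b₁≤b , b₂≤b
    with IsRoundedIdeal.directed (r-ideal b) (Prop-r.r-≤-trans rxb₁ b₁≤b) (Prop-r.r-≤-trans ryb₂ b₂≤b)
  ... | z , rzb , x≤z , y≤z = z , (b , rzb , sbc) , x≤z , y≤z

ProximityLattices : PreCat (lsuc 0ℓ) (lsuc 0ℓ) 0ℓ
ProximityLattices = SPxJLat ≺-isJARel relComp-isJARel

SPxJLat-isCategory : IsCategory ProximityLattices
SPxJLat-isCategory = record
  { ≈-equiv   = On.isEquivalence JARel.rel ⇔₂-isEquivalence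
  ; ∘-resp-≈  = λ s≈s′ r≈r′ a c → mk⇔
      (λ (b , rab , sbc) → b , to (r≈r′ a b) rab , to (s≈s′ b c) sbc)
      (λ (b , rab , sbc) → b , from (r≈r′ a b) rab , from (s≈s′ b c) sbc)
  ; identityˡ = λ {f = f} a c → let open JARelProperties (JARel.isRel f) in mk⇔
      (λ (b , fab , b≺c) → r-≺-trans fab b≺c)
      (λ fac → let b , b≺c , fab = r-roundedʳ fac in b , fab , b≺c)
  ; identityʳ = λ {f = f} a c → let open JARelProperties (JARel.isRel f) in mk⇔
      (λ (b , a≺b , fbc) → ≺-r-trans a≺b fbc)
      (λ fac → let b , a≺b , fbc = r-roundedˡ fac in b , a≺b , fbc)
  ; assoc     = λ a d → mk⇔
      (λ (b , fab , c , gbc , kcd) → c , (b , fab , gbc) , kcd)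
      (λ (c , (b , fab , gbc) , kcd) → b , fab , c , gbc , kcd)
  }

module FiniteSubsets (X : SContFCovObj) where
  open SContFCovObj X
  open CoverProperties X

  ◂*-lattice : BoundedJoinSemilattice 0ℓ 0ℓ 0ℓ
  ◂*-lattice = record
    { Carrier = Fin S
    ; _≈_     = λ A B → A ◂* B × B ◂* A
    ; _≤_     = _◂*_
    ; _∨_     = _++_
    ; ⊥       = []
    ; isBoundedJoinSemilattice = record
      { isJoinSemilattice = record
        { isPartialOrder = record
          { isPreorder = record
            { isEquivalence = record
              { refl  = ◂*-refl , ◂*-refl
              ; sym   = λ (A◂*B , B◂*A) → B◂*A , A◂*B
              ; trans = λ (A◂*B , B◂*A) (B◂*C , C◂*B) → ◂*-trans A◂*B B◂*C , ◂*-trans C◂*B B◂*A }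
            ; reflexive = proj₁
            ; trans     = ◂*-trans }
          ; antisym = _,_ }
        ; supremum = λ A B → ⊆⇒◂* (xs⊆xs++ys A B) , ⊆⇒◂* (xs⊆ys++xs B A) , λ _ → all-++ }
      ; minimum = λ _ _ () } }

  proximity : SPxJLatObj
  proximity = record
    { lat     = ◂*-lattice
    ; _≺_     = _≪*_
    ; ≺-ideal = λ B → record
      { down      = ◂*-≪*-trans
      ; inhabited = [] , λ _ ()
      ; directed  = λ {A} {A′} A≪*B A′≪*B →
          A ++ A′ , all-++ A≪*B A′≪*B , ⊆⇒◂* (xs⊆xs++ys A A′) , ⊆⇒◂* (xs⊆ys++xs A′ A)
      ; rounded   = λ A → mk⇔ ≪*-interpolate (λ (C , A≪*C , C≪*B) → ≪*-trans A≪*C C≪*B) }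
    ; ≺-upset = λ A → record
      { up      = λ B◂*B′ A≪*B → ≪*-◂*-trans A≪*B B◂*B′
      ; rounded = λ B → mk⇔
          (λ A≪*B → let C , A≪*C , C≪*B = ≪*-interpolate A≪*B in C , C≪*B , A≪*C)
          (λ (C , C≪*B , A≪*C) → ≪*-trans A≪*C C≪*B) }
    ; ≺-⊥ = λ A≪*[] → (λ a a∈A → ≪[]⇒◂[] (A≪*[] a a∈A)) , λ _ ()
    ; ≺-∨ = ≪*-++-split _
    }

open FiniteSubsets using () renaming (proximity to F₀)

pointwise : ∀ X Y → FRel X Y → PRel (F₀ X) (F₀ Y)
pointwise _ _ r A B = ∀ a → a ∈ A → r a B

module _ {X Y : SContFCovObj} {r : FRel X Y} (isJA : IsJAMap X Y r) where
  private
    module X = SContFCovObj X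
    module Y = SContFCovObj Y
    module CX = CoverProperties X
    module CY = CoverProperties Y
  open IsJAMap isJA
  open JAMapProperties isJA

  pointwise-isJARel : IsJARel (F₀ X) (F₀ Y) (pointwise X Y r)
  pointwise-isJARel = record
    { r-ideal = λ B → record
      { down      = λ A′◂*A A-r a a∈A′ → r-◂ˡ (A′◂*A a a∈A′) A-r
      ; inhabited = [] , λ _ ()
      ; directed  = λ {A} {A′} A-r A′-r →
          A ++ A′ , all-++ A-r A′-r , CX.⊆⇒◂* (xs⊆xs++ys A A′) , CX.⊆⇒◂* (xs⊆ys++xs A′ A)
      ; rounded   = λ A → mk⇔ (interpolateˡ A B) (λ (C , A≪*C , C-r) a a∈A → r-≪ˡ (A≪*C a a∈A) C-r) }
    ; r-upset = λ A → record
      { up      = λ B◂*B′ A-r a a∈A → r-◂*ʳ (A-r a a∈A) B◂*B′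
      ; rounded = λ B → mk⇔ (interpolateʳ A B)
          (λ (C , C≪*B , A-rC) a a∈A → from (r-right a B) (C , A-rC a a∈A , C≪*B)) }
    ; r-⊥ = λ A-r[] → (λ a a∈A → let A′ , a◂A′ , A′-r = r-split a [] (A-r[] a a∈A) in
                                    CX.◂-⊆ a◂A′ (noWitness⇒⊆[] A′-r)) , λ _ ()
    ; r-∨ = λ {A} → split-++ A
    }
    where
    interpolateˡ : ∀ A B → pointwise X Y r A B → Σ[ C ∈ Fin X.S ] (A CX.≪* C × pointwise X Y r C B)
    interpolateˡ A B A-r with chooseUnion {Q = X._≪_} {R = λ e → r e B} A (λ a a∈A → from (r-left a B) (A-r a a∈A))
    ... | C , chosen , C-r = C , (λ a a∈A → let E , a≪E , E⊆C = chosen a a∈A in CX.≪-⊆ a≪E E⊆C) , C-r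

    interpolateʳ : ∀ A B → pointwise X Y r A B → Σ[ C ∈ Fin Y.S ] (C CY.≪* B × pointwise X Y r A C)
    interpolateʳ A B A-r with chooseUnion {Q = r} {R = λ c → c Y.≪ B} A (λ a a∈A → to (r-right a B) (A-r a a∈A))
    ... | C , chosen , C≪*B = C , C≪*B , λ a a∈A → let E , raE , E⊆C = chosen a a∈A in r-⊆ raE E⊆C

    split-++ : ∀ {B C} A → pointwise X Y r A (B ++ C) →
               Σ[ B′ ∈ Fin X.S ] Σ[ C′ ∈ Fin X.S ]
                 (A CX.◂* B′ ++ C′ × pointwise X Y r B′ B × pointwise X Y r C′ C)
    split-++ {B} A A-r = CX.◂*-partition A λ a a∈A →
      let D , a◂D , D-r = r-split a _ (A-r a a∈A) in
      D , a◂D , λ d d∈D → let c , c∈B++C , rdc = D-r d d∈D in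
        [ (λ c∈B → inj₁ (r-⊆ rdc [ c∈B ]⊆)) , (λ c∈C → inj₂ (r-⊆ rdc [ c∈C ]⊆)) ]′ (∈-++⁻ B c∈B++C)

pointwise-cutComp : ∀ {X Y Z} {r : FRel X Y} (s : FRel Y Z) → IsJAMap X Y r →
                    PRelEq (F₀ X) (F₀ Z) (pointwise X Z (cutComp X Y Z s r))
                           (relComp (F₀ X) (F₀ Y) (F₀ Z) (pointwise Y Z s) (pointwise X Y r))
pointwise-cutComp {X} {Y} {Z} {r} s isJA A C = mk⇔ merge (λ (B , A-r , B-s) a a∈A → B , A-r a a∈A , B-s)
  where
  merge : pointwise X Z (cutComp X Y Z s r) A C →
          relComp (F₀ X) (F₀ Y) (F₀ Z) (pointwise Y Z s) (pointwise X Y r) A C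
  merge A-sr with chooseUnion {Q = r} {R = λ b → s b C} A A-sr
  ... | B , chosen , B-s = B , (λ a a∈A → let E , raE , E⊆B = chosen a a∈A in JAMapProperties.r-⊆ isJA raE E⊆B) , B-s

coverToProximity : Functor Covers ProximityLattices
coverToProximity = record
  { F₀     = FiniteSubsets.proximity
  ; F₁     = λ {X} {Y} f → record { rel = pointwise X Y (JAMap.rel f) ; isRel = pointwise-isJARel (JAMap.isMap f) }
  ; F-resp = λ f≈g A B → mk⇔ (λ A-f a a∈A → to (f≈g a B) (A-f a a∈A))
                             (λ A-g a a∈A → from (f≈g a B) (A-g a a∈A))
  ; F-id   = λ _ _ → ⇔-refl
  ; F-∘    = λ {X} {Y} {Z} f g → pointwise-cutComp {X} {Y} {Z} (JAMap.rel g) (JAMap.isMap f)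
  }

module JoinCover (L : SPxJLatObj) where
  open SPxJLatObj L
  open BoundedJoinSemilattice lat using (Carrier; _≤_) renaming (refl to ≤-refl; trans to ≤-trans)
  open ProximityProperties L
  open JARelProperties (≺-isJARel L) using (r-⋁-split)

  cover : SContFCovObj
  cover = record
    { S        = Carrier
    ; _◂_      = λ a A → a ≤ ⋁ A
    ; _⊏_      = _≺_
    ; ◂-ext    = λ A≐B a≤⋁A → ≤-trans a≤⋁A (⋁-mono (≐⇒⊆ A≐B))
    ; ◂-refl   = ⋁-upperBound
    ; ◂-weaken = λ A B a≤⋁A → ≤-trans a≤⋁A (⋁-mono (xs⊆xs++ys A B))
    ; ◂-cut    = λ {b = b} A a≤⋁A+b b≤⋁A →
        ≤-trans a≤⋁A+b (⋁-least {A ++ [ b ]} (all-++ (λ _ → ⋁-upperBound) all-[ b≤⋁A ]))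
    ; ⊏-idem   = λ a c → ⇔-sym (IsRoundedIdeal.rounded (≺-ideal c) a)
    -- The strongness axioms of ≺, iterated along A, split a ≺ ⋁ A.
    ; strong   = λ a A → mk⇔
        (λ (b , a≺b , b≤⋁A) → r-⋁-split A (≺-≤-trans a≺b b≤⋁A))
        (λ (B , a≤⋁B , B≺*A) → ⋁ A , ≤-≺-trans a≤⋁B (⋁-≺ λ b b∈B →
           let c , c∈A , b≺c = B≺*A b b∈B in ≺-≤-trans b≺c (⋁-upperBound c∈A)) , ≤-refl)
    }

  open CoverProperties cover using (_≪*_)

  ≪*⇔⋁≺⋁ : ∀ {A B} → A ≪* B ⇔ ⋁ A ≺ ⋁ B
  ≪*⇔⋁≺⋁ {A} {B} = mk⇔ ≪*⇒⋁≺⋁ ⋁≺⋁⇒≪*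
    where
    ≪*⇒⋁≺⋁ : A ≪* B → ⋁ A ≺ ⋁ B
    ≪*⇒⋁≺⋁ A≪*B = ⋁-≺ λ a a∈A → let b , a≺b , b≤⋁B = A≪*B a a∈A in ≺-≤-trans a≺b b≤⋁B
    ⋁≺⋁⇒≪* : ⋁ A ≺ ⋁ B → A ≪* B
    ⋁≺⋁⇒≪* ⋁A≺⋁B a a∈A = ⋁ B , ≤-≺-trans (⋁-upperBound a∈A) ⋁A≺⋁B , ≤-refl

open JoinCover using () renaming (cover to G₀)

atJoin : ∀ X Y → PRel X Y → FRel (G₀ X) (G₀ Y)
atJoin _ Y g a B = g a (BigJoin.⋁ (SPxJLatObj.lat Y) B)

module _ {X Y : SPxJLatObj} {g : PRel X Y} (isJR : IsJARel X Y g) where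
  private
    module LY = BoundedJoinSemilattice (SPxJLatObj.lat Y)
    module PX = ProximityProperties X
    module PY = ProximityProperties Y
  open IsJARel isJR
  open JARelProperties isJR

  atJoin-isJAMap : IsJAMap (G₀ X) (G₀ Y) (atJoin X Y g)
  atJoin-isJAMap = record
    { r-ext   = λ B≐B′ ga⋁B → r-≤-trans ga⋁B (PY.⋁-mono (≐⇒⊆ B≐B′))
    ; r-left  = λ a B → mk⇔
        (λ (A , (a′ , a≺a′ , a′≤⋁A) , A-g) → ≺-r-trans a≺a′ (≤-r-trans a′≤⋁A (PX.ideal-⋁ (r-ideal _) A-g)))
        (λ ga⋁B → let a′ , a≺a′ , ga′⋁B = r-roundedˡ ga⋁B in
                  [ a′ ] , (a′ , a≺a′ , PX.x≤⋁[x] _) , all-[ ga′⋁B ])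
    ; r-right = λ a B → mk⇔
        (λ ga⋁B → let b , b≺⋁B , gab = r-roundedʳ ga⋁B in
                  [ b ] , r-≤-trans gab (PY.x≤⋁[x] _) , all-[ (PY.⋁ B , b≺⋁B , LY.refl) ])
        (λ (C , ga⋁C , C≪*B) → r-≺-trans ga⋁C (to (JoinCover.≪*⇔⋁≺⋁ Y {C} {B}) C≪*B))
    ; r-split = λ a B ga⋁B → let A , a≤⋁A , A-g = r-⋁-split B ga⋁B in
        A , a≤⋁A , λ a′ a′∈A → let b , b∈B , ga′b = A-g a′ a′∈A in
          b , b∈B , r-≤-trans ga′b (PY.x≤⋁[x] _)
    }

atJoin-relComp : ∀ {X Y Z} {f : PRel X Y} (g : PRel Y Z) → IsJARel X Y f → IsJARel Y Z g →
                 FRelEq (G₀ X) (G₀ Z) (atJoin X Z (relComp X Y Z g f))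
                        (cutComp (G₀ X) (G₀ Y) (G₀ Z) (atJoin Y Z g) (atJoin X Y f))
atJoin-relComp {Y = Y} g isJR-f isJR-g a C = mk⇔
  (λ (b , fab , gb⋁C) → [ b ] , JARelProperties.r-≤-trans isJR-f fab (PY.x≤⋁[x] _) , all-[ gb⋁C ])
  (λ (B , fa⋁B , B-g) → PY.⋁ B , fa⋁B , PY.ideal-⋁ (IsJARel.r-ideal isJR-g _) B-g)
  where module PY = ProximityProperties Y

proximityToCover : Functor ProximityLattices Covers
proximityToCover = record
  { F₀     = G₀
  ; F₁     = λ {X} {Y} g → record { rel = atJoin X Y (JARel.rel g) ; isMap = atJoin-isJAMap (JARel.isRel g) }
  ; F-resp = λ f≈g a B → f≈g a _
  ; F-id   = λ {X} a B → let open ProximityProperties X in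
      mk⇔ (λ a≺⋁B → ⋁ B , a≺⋁B , BoundedJoinSemilattice.refl (SPxJLatObj.lat X))
          (λ (b , a≺b , b≤⋁B) → ≺-≤-trans a≺b b≤⋁B)
  ; F-∘    = λ {X} {Y} {Z} f g → atJoin-relComp {X} {Y} {Z} (JARel.rel g) (JARel.isRel f) (JARel.isRel g)
  }

module Unit (X : SContFCovObj) where
  open SContFCovObj X
  open CoverProperties X

  -- The join of F₀ X is foldr _++_ [], i.e. concat, so in GFX a set A is covered by 𝒜 iff A ◂* concat 𝒜.
  GFX : SContFCovObj
  GFX = G₀ (F₀ X)

  private
    module GFX = SContFCovObj GFX

  unit : FRel X GFX
  unit a 𝒜 = a ≪ concat 𝒜

  unit-isJAMap : IsJAMap X GFX unit
  unit-isJAMap = record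
    { r-ext   = λ 𝒜≐𝒜′ a≪∪𝒜 → ≪-⊆ a≪∪𝒜 (concat⁺ (≐⇒⊆ 𝒜≐𝒜′))
    ; r-left  = λ a 𝒜 → ≪-idem a (concat 𝒜)
    ; r-right = λ a 𝒜 → mk⇔
        (λ a≪∪𝒜 → let B , a≪B , B≪*∪𝒜 = ≪-interpolate a≪∪𝒜 in
                  [ B ] , ≪-⊆ a≪B (xs⊆xs++ys B []) , all-[ (concat 𝒜 , B≪*∪𝒜 , ◂*-refl) ])
        (λ (𝒞 , a≪∪𝒞 , 𝒞≪𝒜) → ≪-≪*-trans a≪∪𝒞 (all-concat λ C C∈𝒞 →
           let D , C≪*D , D◂*∪𝒜 = 𝒞≪𝒜 C C∈𝒞 in ≪*-◂*-trans C≪*D D◂*∪𝒜))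
    ; r-split = λ a 𝒜 a≪∪𝒜 → let D , a◂D , D⊏*∪𝒜 = ≪⇒◂⊏* a≪∪𝒜 in
        D , a◂D , λ d d∈D → let c , c∈∪𝒜 , d⊏c = D⊏*∪𝒜 d d∈D
                                B , c∈B , B∈𝒜 = ∈-concat⁻′ 𝒜 c∈∪𝒜 in
          B , B∈𝒜 , ⊏-∈⇒≪ d⊏c (∈-++⁺ˡ c∈B)
    }

  unit⁻¹-isJAMap : IsJAMap GFX X _≪*_
  unit⁻¹-isJAMap = record
    { r-ext   = λ B≐B′ A≪*B → ≪*-◂*-trans A≪*B (⊆⇒◂* (≐⇒⊆ B≐B′))
    ; r-left  = λ A B → mk⇔
        (λ (𝒜 , (D , A≪*D , D◂*∪𝒜) , 𝒜≪*B) → ≪*-trans A≪*D (◂*-≪*-trans D◂*∪𝒜 (all-concat 𝒜≪*B)))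
        (λ A≪*B → let E , A≪*E , E≪*B = ≪*-interpolate A≪*B in
                  [ E ] , (E , A≪*E , ⊆⇒◂* (xs⊆xs++ys E [])) , all-[ E≪*B ])
    ; r-right = λ A B → mk⇔ ≪*-interpolate (λ (C , A≪*C , C≪*B) → ≪*-trans A≪*C C≪*B)
    ; r-split = split
    }
    where
    [e]≪*[c] : ∀ {A′ e c} → A′ ≡ [ e ] → e ⊏ c → A′ ≪* [ c ]
    [e]≪*[c] refl e⊏c = all-[ ⊏-∈⇒≪ e⊏c (here refl) ]

    -- The pieces are the singletons of all the refining sets, so each one is ⊏-below a single point of B.
    split : ∀ A B → A ≪* B →
            Σ[ 𝒜 ∈ Fin (Fin S) ] (A ◂* concat 𝒜 × (∀ A′ → A′ ∈ 𝒜 → Σ[ b ∈ S ] (b ∈ B × A′ ≪* [ b ])))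
    split A B A≪*B with chooseUnion {Q = _◂_} A (λ a a∈A → ≪⇒◂⊏* (A≪*B a a∈A))
    ... | E , chosen , E⊏*B = map [_] E , A◂*∪ , λ A′ A′∈ →
      let e , e∈E , A′≡[e] = ∈-map⁻ [_] A′∈ ; c , c∈B , e⊏c = E⊏*B e e∈E in
      c , c∈B , [e]≪*[c] A′≡[e] e⊏c
      where
      A◂*∪ : A ◂* concat (map [_] E)
      A◂*∪ a a∈A = let D , a◂D , D⊆E = chosen a a∈A in
        ◂-⊆ a◂D (⊆-trans D⊆E (⊆-reflexive (sym (concat-map-[ E ]))))

  η : JAMap X GFX
  η = record { rel = unit ; isMap = unit-isJAMap }

  η⁻¹ : JAMap GFX X
  η⁻¹ = record { rel = _≪*_ ; isMap = unit⁻¹-isJAMap }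

  η⁻¹∘η≈id : FRelEq X X (cutComp X GFX X _≪*_ unit) _≪_
  η⁻¹∘η≈id a C = mk⇔
    (λ (𝒜 , a≪∪𝒜 , 𝒜≪*C) → ≪-≪*-trans a≪∪𝒜 (all-concat 𝒜≪*C))
    (λ a≪C → let B , a≪B , B≪*C = ≪-interpolate a≪C in [ B ] , ≪-⊆ a≪B (xs⊆xs++ys B []) , all-[ B≪*C ])

  η∘η⁻¹≈id : FRelEq GFX GFX (cutComp GFX X GFX unit _≪*_) GFX._≪_
  η∘η⁻¹≈id A 𝒞 = mk⇔
    (λ (B , A≪*B , B≪*∪𝒞) → concat 𝒞 , ≪*-trans A≪*B B≪*∪𝒞 , ◂*-refl)
    (λ (D , A≪*D , D◂*∪𝒞) → let E , A≪*E , E≪*D = ≪*-interpolate A≪*D in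
                             E , A≪*E , ≪*-◂*-trans E≪*D D◂*∪𝒞)

η-natural : ∀ {X Y} (f : JAMap X Y) →
            FRelEq X (Unit.GFX Y) (cutComp X Y (Unit.GFX Y) (Unit.unit Y) (JAMap.rel f))
                   (cutComp X (Unit.GFX X) (Unit.GFX Y)
                            (atJoin (F₀ X) (F₀ Y) (pointwise X Y (JAMap.rel f))) (Unit.unit X))
-- Both sides are equivalent to f a (concat 𝒞), by roundedness of f on the right resp. the left.
η-natural {X} {Y} f a 𝒞 = ⇔-trans (⇔-sym (r-right a (concat 𝒞))) (mk⇔
  (λ fa∪𝒞 → let A , a≪A , A-f = from (r-left a (concat 𝒞)) fa∪𝒞 in
            [ A ] , CX.≪-⊆ a≪A (xs⊆xs++ys A []) , all-[ A-f ])
  (λ (𝒜 , a≪∪𝒜 , 𝒜-f) → r-≪ˡ a≪∪𝒜 (all-concat 𝒜-f)))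
  where
  module CX = CoverProperties X
  open IsJAMap (JAMap.isMap f)
  open JAMapProperties (JAMap.isMap f) using (r-≪ˡ)

module Counit (L : SPxJLatObj) where
  open SPxJLatObj L
  open BoundedJoinSemilattice lat using (joinSemilattice; reflexive) renaming (refl to ≤-refl; trans to ≤-trans)
  open ProximityProperties L
  open JoinCover L using (≪*⇔⋁≺⋁)
  open CoverProperties (G₀ L) using (_≪*_; ⊆⇒◂*)

  FGL : SPxJLatObj
  FGL = F₀ (G₀ L)

  counit : PRel FGL L
  counit A b = ⋁ A ≺ b

  counit⁻¹ : PRel L FGL
  counit⁻¹ a B = a ≺ ⋁ B

  ⋁≺⇒≪*[-] : ∀ {A y} → ⋁ A ≺ y → A ≪* [ y ]
  ⋁≺⇒≪*[-] {A} {y} ⋁A≺y = from (≪*⇔⋁≺⋁ {A} {[ y ]}) (≺-≤-trans ⋁A≺y (x≤⋁[x] y))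

  counit-isJARel : IsJARel FGL L counit
  counit-isJARel = record
    { r-ideal = λ b → record
      { down      = λ A′◂*A ⋁A≺b → ≤-≺-trans (⋁-least A′◂*A) ⋁A≺b
      ; inhabited = [] , ⋁-≺ {A = []} (λ _ ())
      ; directed  = λ {A} {A′} ⋁A≺b ⋁A′≺b → A ++ A′
          , ⋁-≺ {A ++ A′} (all-++ {A = A} (λ _ a∈A → ≤-≺-trans (⋁-upperBound a∈A) ⋁A≺b)
                        (λ _ a∈A′ → ≤-≺-trans (⋁-upperBound a∈A′) ⋁A′≺b))
          , ⊆⇒◂* (xs⊆xs++ys A A′) , ⊆⇒◂* (xs⊆ys++xs A′ A)
      ; rounded   = λ A → mk⇔
          (λ ⋁A≺b → let y , ⋁A≺y , y≺b = ≺-interpolate ⋁A≺b in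
                    [ y ] , ⋁≺⇒≪*[-] ⋁A≺y , ≤-≺-trans (⋁[x]≤x y) y≺b)
          (λ (C , A≪*C , ⋁C≺b) → ≺-trans (to (≪*⇔⋁≺⋁ {A} {C}) A≪*C) ⋁C≺b) }
    ; r-upset = λ A → record
      { up      = λ b≤b′ ⋁A≺b → ≺-≤-trans ⋁A≺b b≤b′
      ; rounded = λ b → mk⇔
          (λ ⋁A≺b → let y , ⋁A≺y , y≺b = ≺-interpolate ⋁A≺b in y , y≺b , ⋁A≺y)
          (λ (y , y≺b , ⋁A≺y) → ≺-trans ⋁A≺y y≺b) }
    ; r-⊥     = λ ⋁A≺⊥ → (λ _ a∈A → ≤-trans (⋁-upperBound a∈A) (reflexive (≺-⊥ ⋁A≺⊥))) , λ _ ()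
    ; r-∨     = λ {A} ⋁A≺b∨c → let b′ , c′ , ⋁A≤b′∨c′ , b′≺b , c′≺c = ≺-∨ ⋁A≺b∨c in
        [ b′ ] , [ c′ ]
        , (λ _ a∈A → ≤-trans (⋁-upperBound a∈A)
                       (≤-trans ⋁A≤b′∨c′ (∨-monotonic joinSemilattice ≤-refl (x≤⋁[x] c′))))
        , ≤-≺-trans (⋁[x]≤x b′) b′≺b , ≤-≺-trans (⋁[x]≤x c′) c′≺c
    }

  counit⁻¹-isJARel : IsJARel L FGL counit⁻¹
  counit⁻¹-isJARel = record
    { r-ideal = λ B → ≺-ideal (⋁ B)
    ; r-upset = λ a → record
      { up      = λ B◂*B′ a≺⋁B → ≺-≤-trans a≺⋁B (⋁-least B◂*B′)
      ; rounded = λ B → mk⇔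
          (λ a≺⋁B → let y , a≺y , y≺⋁B = ≺-interpolate a≺⋁B in
                    [ y ] , from (≪*⇔⋁≺⋁ {[ y ]} {B}) (≤-≺-trans (⋁[x]≤x y) y≺⋁B) , ≺-≤-trans a≺y (x≤⋁[x] y))
          (λ (C , C≪*B , a≺⋁C) → ≺-trans a≺⋁C (to (≪*⇔⋁≺⋁ {C} {B}) C≪*B)) }
    ; r-⊥     = ≺-⊥
    ; r-∨     = λ {a} {B} {C} a≺⋁B++C → ≺-∨ (≺-≤-trans a≺⋁B++C (⋁-++ B C))
    }

  ε : JARel FGL L
  ε = record { rel = counit ; isRel = counit-isJARel }

  ε⁻¹ : JARel L FGL
  ε⁻¹ = record { rel = counit⁻¹ ; isRel = counit⁻¹-isJARel }

  ε⁻¹∘ε≈id : PRelEq FGL FGL (relComp FGL L FGL counit⁻¹ counit) _≪*_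
  ε⁻¹∘ε≈id A C = mk⇔
    (λ (b , ⋁A≺b , b≺⋁C) → from (≪*⇔⋁≺⋁ {A} {C}) (≺-trans ⋁A≺b b≺⋁C))
    (λ A≪*C → ≺-interpolate (to (≪*⇔⋁≺⋁ {A} {C}) A≪*C))

  ε∘ε⁻¹≈id : PRelEq L L (relComp L FGL L counit counit⁻¹) _≺_
  ε∘ε⁻¹≈id a c = mk⇔
    (λ (B , a≺⋁B , ⋁B≺c) → ≺-trans a≺⋁B ⋁B≺c)
    (λ a≺c → let y , a≺y , y≺c = ≺-interpolate a≺c in
             [ y ] , ≺-≤-trans a≺y (x≤⋁[x] y) , ≤-≺-trans (⋁[x]≤x y) y≺c)

ε-natural : ∀ {X Y} (g : JARel X Y) →
            PRelEq (Counit.FGL X) Y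
              (relComp (Counit.FGL X) (Counit.FGL Y) Y (Counit.counit Y)
                       (pointwise (G₀ X) (G₀ Y) (atJoin X Y (JARel.rel g))))
              (relComp (Counit.FGL X) X Y (JARel.rel g) (Counit.counit X))
ε-natural {X} {Y} g A c = mk⇔
  (λ (B , A-g⋁B , ⋁B≺c) → r-roundedˡ (r-≺-trans (PX.ideal-⋁ (r-ideal _) A-g⋁B) ⋁B≺c))
  (λ (b , ⋁A≺b , gbc) → let y , y≺c , gby = r-roundedʳ gbc ; g⋁Ay = ≺-r-trans ⋁A≺b gby in
    [ y ] , (λ _ a∈A → r-≤-trans (≤-r-trans (PX.⋁-upperBound a∈A) g⋁Ay) (PY.x≤⋁[x] y))
    , PY.≤-≺-trans (PY.⋁[x]≤x y) y≺c)
  where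
  module PX = ProximityProperties X
  module PY = ProximityProperties Y
  open IsJARel (JARel.isRel g) using (r-ideal)
  open JARelProperties (JARel.isRel g)

equivalence : Equivalence Covers ProximityLattices
equivalence = record
  { F         = coverToProximity
  ; G         = proximityToCover
  ; η         = Unit.η
  ; η⁻¹       = Unit.η⁻¹
  ; η-isoˡ    = Unit.η⁻¹∘η≈id
  ; η-isoʳ    = Unit.η∘η⁻¹≈id
  ; η-natural = η-natural
  ; ε         = Counit.ε
  ; ε⁻¹       = Counit.ε⁻¹
  ; ε-isoˡ    = Counit.ε⁻¹∘ε≈id
  ; ε-isoʳ    = Counit.ε∘ε⁻¹≈id
  ; ε-natural = ε-natural
  }

theorem4p21 : Σ[ idC ∈ SContIdOK ] Σ[ compC ∈ SContCompOK ]
              Σ[ idP ∈ SPxIdOK ] Σ[ compP ∈ SPxCompOK ]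
                (IsCategory (SContFCov idC compC) ×
                 IsCategory (SPxJLat idP compP) ×
                 Equivalence (SContFCov idC compC) (SPxJLat idP compP))
theorem4p21 = ≪-isJAMap , cutComp-isJAMap , ≺-isJARel , relComp-isJARel
            , SContFCov-isCategory , SPxJLat-isCategory , equivalence
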